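{- Let $m\ge3$ and let $\Delta$ be a graph with vertex set $\{1,-1,2,-2,\dots,m,-m\}$ whose automorphism group contains the group $W$ of all permutations of the form $\varepsilon i\mapsto \varepsilon v_i\,\sigma(i)$ where $\sigma\in\mathrm{Sym}(m)$ and $(v_1,\dots,v_m)\in\{1,-1\}^m$ has an even number of entries equal to $-1$. Then $\Delta$ is isomorphic to $K_{2m}$, $\overline{K_{2m}}$, $mK_2$ or $\overline{mK_2}$. In particular, all such graphs $\Delta$ have motion $2$.
   Context: $\varepsilon\in\{1,-1\}$, $i\in\{1,\dots,m\}$. $K_{2m}$ is the complete graph, $mK_2$ a perfect matching on $2m$ vertices, overline denotes complement. The motion of a graph is the minimum number of vertices moved by a non-identity automorphism. -}

module Defs where

open import Data.Nat using (ℕ; _≤_)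
open import Data.Nat.DivMod using (_%_)
open import Data.Bool using (Bool; true; false; _xor_; not; _∧_; if_then_else_)
open import Data.Fin using (Fin)
open import Data.Fin.Properties using () renaming (_≟_ to _≟F_)
open import Data.List using (List; length; filter; filterᵇ; cartesianProduct; _∷_; [])
open import Data.List.Base using (allFin)
open import Data.Product using (_×_; _,_; proj₁; proj₂; Σ; ∃; ∃-syntax)
open import Data.Product.Properties using (≡-dec)
open import Data.Bool.Properties using () renaming (_≟_ to _≟B_)
open import Data.Sum using (_⊎_)
open import Function.Bundles using (_↔_; Inverse)
open import Relation.Binary.PropositionalEquality using (_≡_)
open import Relation.Nullary using (¬_; Dec; does)
open import Relation.Nullary.Decidable using (⌊_⌋)

-- Vertex εi is encoded as (i , s) with s = true meaning ε = -1, s = false meaning ε = +1.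
V : ℕ → Set
V m = Fin m × Bool

_≟V_ : ∀ {m} (x y : V m) → Dec (x ≡ y)
_≟V_ = ≡-dec _≟F_ _≟B_

allV : (m : ℕ) → List (V m)
allV m = cartesianProduct (allFin m) (true ∷ false ∷ [])

record Graph (m : ℕ) : Set where
  field
    adj   : V m → V m → Bool
    sym   : ∀ x y → adj x y ≡ adj y x
    loopless : ∀ x → adj x x ≡ false
open Graph public

IsAut : ∀ {m} → Graph m → (V m → V m) → Set
IsAut Δ f = ∀ x y → adj Δ (f x) (f y) ≡ adj Δ x y

negCount : ∀ {m} → (Fin m → Bool) → ℕ
negCount {m} v = length (filterᵇ v (allFin m))

wAct : ∀ {m} → (Fin m ↔ Fin m) → (Fin m → Bool) → V m → V m
wAct σ v (i , s) = (Inverse.to σ i , s xor v i)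

WInvariant : ∀ {m} → Graph m → Set
WInvariant {m} Δ = ∀ (σ : Fin m ↔ Fin m) (v : Fin m → Bool) → negCount v % 2 ≡ 0 → IsAut Δ (wAct σ v)

neqV : ∀ {m} → V m → V m → Bool
neqV x y = not ⌊ x ≟V y ⌋

matchV : ∀ {m} → V m → V m → Bool
matchV (i , s) (j , t) = ⌊ i ≟F j ⌋ ∧ not ⌊ s ≟B t ⌋

K : (m : ℕ) → V m → V m → Bool
K m = neqV

coK : (m : ℕ) → V m → V m → Bool
coK m x y = false

mK2 : (m : ℕ) → V m → V m → Bool
mK2 m = matchV

comK2 : (m : ℕ) → V m → V m → Bool
comK2 m x y = neqV x y ∧ not (matchV x y)

IsoTo : ∀ {m} → Graph m → (V m → V m → Bool) → Set
IsoTo {m} Δ a = Σ (V m ↔ V m) λ f → ∀ x y → a (Inverse.to f x) (Inverse.to f y) ≡ adj Δ x y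

moved : ∀ {m} → (V m → V m) → ℕ
moved {m} f = length (filterᵇ (λ x → not ⌊ f x ≟V x ⌋) (allV m))

MotionIs : ∀ {m} → Graph m → ℕ → Set
MotionIs {m} Δ k =
  (Σ (V m ↔ V m) λ f → IsAut Δ (Inverse.to f) × (∃[ x ] ¬ (Inverse.to f x ≡ x)) × moved (Inverse.to f) ≡ k)
  × (∀ (f : V m ↔ V m) → IsAut Δ (Inverse.to f) → (∃[ x ] ¬ (Inverse.to f x ≡ x)) → k ≤ moved (Inverse.to f))

module Submission where

-- W preserves the two kinds of pairs of distinct vertices, the antipodal pairs {i, -i} and the
-- pairs with distinct indices, and is transitive on each kind: index transpositions move any
-- (pair of) indices to any other, and flipping the signs at i and at a third index k changes
-- the sign of i alone in a pair {±i, ±j}; this is where m ≥ 3 is needed. Hence adjacency in Δ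
-- is given by two bits, one per kind, and the four choices are the four graphs. Each of them has
-- the automorphism exchanging 1 and -1, which moves two vertices, and no non-identity
-- permutation moves fewer.

open import Defs hiding (sym)
open import Data.Bool using (Bool; true; false; not; _∨_; _xor_; if_then_else_; T; T?)
open import Data.Bool.Properties using (xor-comm; xor-identityʳ; ∨-identityʳ; ¬-not)
  renaming (_≟_ to _≟B_)
open import Data.Fin using (Fin; zero; suc)
open import Data.Fin.Properties using () renaming (_≟_ to _≟F_)
import Data.Fin.Permutation as Perm
open import Data.Fin.Permutation.Components using (transpose)
open import Data.List using (List; []; _∷_; length; filterᵇ; tabulate; cartesianProduct)
open import Data.List.Membership.Propositional using (_∈_)
open import Data.List.Membership.Propositional.Properties
  using (∈-filter⁺; ∈-cartesianProduct⁺; ∈-cartesianProduct⁻; ∈-tabulate⁻; ∈-allFin)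
open import Data.List.Properties using (filter-none)
import Data.List.Relation.Unary.All as All
open import Data.List.Relation.Unary.Any using (here; there)
open import Data.Nat using (ℕ; zero; suc; _+_; _≤_; z≤n; s≤s)
open import Data.Nat.DivMod using (_%_)
open import Data.Nat.Properties using (m≤n⇒m≤1+n)
open import Data.Product using (_×_; _,_; proj₁; ∃-syntax)
open import Data.Sum using (_⊎_; inj₁; inj₂)
open import Function using (_∘_)
open import Function.Bundles using (_↔_; Inverse; Injection; mk↔ₛ′)
open import Function.Construct.Identity using (↔-id)
open import Function.Properties.Inverse using (↔⇒↣)
open import Relation.Binary.PropositionalEquality
open import Relation.Nullary using (¬_; yes; no; contradiction)
open import Relation.Nullary.Decidable using (⌊_⌋; dec-true; dec-false; fromWitnessFalse; toWitnessFalse)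

length-filterᵇ-tabulate : ∀ {a b} {A : Set a} {B : Set b} {n} (p : A → Bool) (g : Fin n → A)
  (q : B → Bool) (h : Fin n → B) → (∀ i → p (g i) ≡ q (h i)) →
  length (filterᵇ p (tabulate g)) ≡ length (filterᵇ q (tabulate h))
length-filterᵇ-tabulate {n = zero} p g q h pg≡qh = refl
length-filterᵇ-tabulate {n = suc n} p g q h pg≡qh
  with p (g zero) | q (h zero) | pg≡qh zero
     | length-filterᵇ-tabulate p (g ∘ suc) q (h ∘ suc) (pg≡qh ∘ suc)
... | true  | .true  | refl | rest = cong suc rest
... | false | .false | refl | rest = rest

distinct-members⇒2≤length : ∀ {a} {A : Set a} {xs : List A} {x y : A} →
  x ∈ xs → y ∈ xs → x ≢ y → 2 ≤ length xs
distinct-members⇒2≤length (here refl)        (here refl)        x≢y = contradiction refl x≢y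
distinct-members⇒2≤length (here _)           (there (here _))   _   = s≤s (s≤s z≤n)
distinct-members⇒2≤length (here _)           (there (there _))  _   = s≤s (s≤s z≤n)
distinct-members⇒2≤length (there (here _))   (here _)           _   = s≤s (s≤s z≤n)
distinct-members⇒2≤length (there (there _))  (here _)           _   = s≤s (s≤s z≤n)
distinct-members⇒2≤length (there x∈)         (there y∈)         x≢y =
  m≤n⇒m≤1+n (distinct-members⇒2≤length x∈ y∈ x≢y)

negCount-suc : ∀ {n} (v : Fin (suc n) → Bool) →
  negCount v ≡ (if v zero then 1 else 0) + negCount (v ∘ suc)
negCount-suc v with v zero | length-filterᵇ-tabulate v suc (v ∘ suc) (λ i → i) (λ _ → refl)
... | true  | rest = cong suc rest
... | false | rest = rest

negCount-cong : ∀ {n} {v w : Fin n → Bool} → (∀ k → v k ≡ w k) → negCount v ≡ negCount w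
negCount-cong {v = v} {w} v≗w = length-filterᵇ-tabulate v (λ i → i) w (λ i → i) v≗w

negCount-false : ∀ n → negCount {n} (λ _ → false) ≡ 0
negCount-false zero    = refl
negCount-false (suc n) = trans (negCount-suc {n} (λ _ → false)) (negCount-false n)

≟-suc : ∀ {n} (k p : Fin n) → ⌊ suc k ≟F suc p ⌋ ≡ ⌊ k ≟F p ⌋
≟-suc k p with k ≟F p
... | yes _ = refl
... | no _  = refl

negCount-single : ∀ {n} (p : Fin n) → negCount (λ k → ⌊ k ≟F p ⌋) ≡ 1
negCount-single {suc n} zero    =
  trans (negCount-suc {n} (λ k → ⌊ k ≟F zero ⌋)) (cong suc (negCount-false n))
negCount-single {suc n} (suc p) =
  trans (negCount-suc {n} (λ k → ⌊ k ≟F suc p ⌋))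
        (trans (negCount-cong (λ k → ≟-suc k p)) (negCount-single p))

negativeAt : ∀ {m} → Fin m → Fin m → Fin m → Bool
negativeAt p q k = ⌊ k ≟F p ⌋ ∨ ⌊ k ≟F q ⌋

negCount-negativeAt : ∀ {n} {p q : Fin n} → p ≢ q → negCount (negativeAt p q) ≡ 2
negCount-negativeAt {suc n} {zero}  {zero}  p≢q = contradiction refl p≢q
negCount-negativeAt {suc n} {zero}  {suc q} _   =
  trans (negCount-suc {n} (negativeAt zero (suc q)))
        (cong suc (trans (negCount-cong (λ k → ≟-suc k q)) (negCount-single q)))
negCount-negativeAt {suc n} {suc p} {zero}  _   =
  trans (negCount-suc {n} (negativeAt (suc p) zero))
        (cong suc (trans (negCount-cong λ k → trans (∨-identityʳ _) (≟-suc k p))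
                         (negCount-single p)))
negCount-negativeAt {suc n} {suc p} {suc q} p≢q =
  trans (negCount-suc {n} (negativeAt (suc p) (suc q)))
        (trans (negCount-cong λ k → cong₂ _∨_ (≟-suc k p) (≟-suc k q))
               (negCount-negativeAt (p≢q ∘ cong suc)))

transpose-matchˡ : ∀ {n} (i j : Fin n) → transpose i j i ≡ j
transpose-matchˡ i j rewrite dec-true (i ≟F i) refl = refl

transpose-fix : ∀ {n} {i j k : Fin n} → k ≢ i → k ≢ j → transpose i j k ≡ k
transpose-fix {i = i} {j} {k} k≢i k≢j
  rewrite dec-false (k ≟F i) k≢i | dec-false (k ≟F j) k≢j = refl

fresh : ∀ {n} (i j : Fin (suc (suc (suc n)))) → ∃[ k ] k ≢ i × k ≢ j
fresh zero          zero          = suc zero       , (λ ()) , (λ ())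
fresh zero          (suc zero)    = suc (suc zero) , (λ ()) , (λ ())
fresh zero          (suc (suc _)) = suc zero       , (λ ()) , (λ ())
fresh (suc zero)    zero          = suc (suc zero) , (λ ()) , (λ ())
fresh (suc (suc _)) zero          = suc zero       , (λ ()) , (λ ())
fresh (suc _)       (suc _)       = zero           , (λ ()) , (λ ())

flipSigns : ∀ {m} → Fin m → Fin m → V m → V m
flipSigns p q = wAct (↔-id _) (negativeAt p q)

flipSigns-at : ∀ {m} (p q : Fin m) (s : Bool) → flipSigns p q (p , s) ≡ (p , not s)
flipSigns-at p q s with p ≟F p
... | yes _   = cong (p ,_) (xor-comm s true)
... | no p≢p  = contradiction refl p≢p

flipSigns-off : ∀ {m} {p q j : Fin m} (t : Bool) → j ≢ p → j ≢ q → flipSigns p q (j , t) ≡ (j , t)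
flipSigns-off {p = p} {q} {j} t j≢p j≢q with j ≟F p | j ≟F q
... | yes j≡p | _       = contradiction j≡p j≢p
... | no _    | yes j≡q = contradiction j≡q j≢q
... | no _    | no _    = cong (j ,_) (xor-identityʳ t)

module WInvariance {m} (Δ : Graph m) (W : WInvariant Δ) where
  open ≡-Reasoning

  permute-invariant : (σ : Fin m ↔ Fin m) {i j i' j' : Fin m} {s t : Bool} →
    Inverse.to σ i ≡ i' → Inverse.to σ j ≡ j' → adj Δ (i , s) (j , t) ≡ adj Δ (i' , s) (j' , t)
  permute-invariant σ {i} {j} {s = s} {t} refl refl = begin
    adj Δ (i , s) (j , t)
      ≡⟨ W σ (λ _ → false) (cong (_% 2) (negCount-false m)) (i , s) (j , t) ⟨
    adj Δ (σ.to i , s xor false) (σ.to j , t xor false)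
      ≡⟨ cong₂ (λ s' t' → adj Δ (σ.to i , s') (σ.to j , t')) (xor-identityʳ s) (xor-identityʳ t) ⟩
    adj Δ (σ.to i , s) (σ.to j , t) ∎
    where module σ = Inverse σ

  flipSigns-invariant : {p q : Fin m} → p ≢ q →
    ∀ x y → adj Δ (flipSigns p q x) (flipSigns p q y) ≡ adj Δ x y
  flipSigns-invariant {p} {q} p≢q =
    W (↔-id _) (negativeAt p q) (cong (_% 2) (negCount-negativeAt p≢q))

  sign-irrelevantˡ : {i j k : Fin m} → k ≢ i → k ≢ j → i ≢ j →
    ∀ s t → adj Δ (i , s) (j , t) ≡ adj Δ (i , false) (j , t)
  sign-irrelevantˡ _ _ _ false t = refl
  sign-irrelevantˡ {i} {j} {k} k≢i k≢j i≢j true t = begin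
    adj Δ (i , true) (j , t)
      ≡⟨ cong₂ (adj Δ) (flipSigns-at i k false) (flipSigns-off t (i≢j ∘ sym) (k≢j ∘ sym)) ⟨
    adj Δ (flipSigns i k (i , false)) (flipSigns i k (j , t))
      ≡⟨ flipSigns-invariant (k≢i ∘ sym) (i , false) (j , t) ⟩
    adj Δ (i , false) (j , t) ∎

  antipodal-uniform : (i i' : Fin m) (s : Bool) →
    adj Δ (i , s) (i , not s) ≡ adj Δ (i' , s) (i' , not s)
  antipodal-uniform i i' s =
    permute-invariant (Perm.transpose i i') (transpose-matchˡ i i') (transpose-matchˡ i i')

  distinct-uniform : {i j i' j' : Fin m} {s t : Bool} → i ≢ j → i' ≢ j' →
    adj Δ (i , s) (j , t) ≡ adj Δ (i' , s) (j' , t)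
  distinct-uniform {i} {j} {i'} {j'} i≢j i'≢j' =
    trans (permute-invariant τ (transpose-matchˡ i i') refl)
          (permute-invariant (Perm.transpose j'' j') (transpose-fix i'≢j'' i'≢j')
                             (transpose-matchˡ j'' j'))
    where
    τ : Fin m ↔ Fin m
    τ = Perm.transpose i i'
    j'' : Fin m
    j'' = transpose i i' j
    i'≢j'' : i' ≢ j''
    i'≢j'' i'≡j'' = i≢j (Injection.injective (↔⇒↣ τ) (trans (transpose-matchˡ i i') i'≡j''))

orbitalGraph : ∀ {m} → Bool → Bool → V m → V m → Bool
orbitalGraph α β (i , s) (j , t) = if ⌊ i ≟F j ⌋ then (if ⌊ s ≟B t ⌋ then false else α) else β

module _ {n} (Δ : Graph (suc (suc (suc n)))) (W : WInvariant Δ) where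
  open ≡-Reasoning
  open WInvariance Δ W

  signs-irrelevant : {i j : Fin (suc (suc (suc n)))} → i ≢ j →
    ∀ s t → adj Δ (i , s) (j , t) ≡ adj Δ (i , false) (j , false)
  signs-irrelevant {i} {j} i≢j s t with fresh i j
  ... | k , k≢i , k≢j = begin
    adj Δ (i , s) (j , t)          ≡⟨ sign-irrelevantˡ k≢i k≢j i≢j s t ⟩
    adj Δ (i , false) (j , t)      ≡⟨ Graph.sym Δ _ _ ⟩
    adj Δ (j , t) (i , false)      ≡⟨ sign-irrelevantˡ k≢j k≢i (i≢j ∘ sym) t false ⟩
    adj Δ (j , false) (i , false)  ≡⟨ Graph.sym Δ _ _ ⟩
    adj Δ (i , false) (j , false)  ∎

  antipodal : ∀ i s → adj Δ (i , s) (i , not s) ≡ adj Δ (zero , false) (zero , true)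
  antipodal i false = antipodal-uniform i zero false
  antipodal i true  = trans (antipodal-uniform i zero true) (Graph.sym Δ _ _)

  adj-orbital : ∀ x y → adj Δ x y ≡
    orbitalGraph (adj Δ (zero , false) (zero , true)) (adj Δ (zero , false) (suc zero , false)) x y
  adj-orbital (i , s) (j , t) with i ≟F j
  ... | no i≢j = trans (signs-irrelevant i≢j s t) (distinct-uniform i≢j λ ())
  ... | yes refl with s ≟B t
  ...   | yes refl = loopless Δ (i , s)
  ...   | no s≢t rewrite ¬-not (s≢t ∘ sym) = antipodal i s

K-orbital : ∀ {m} (x y : V m) → K m x y ≡ orbitalGraph true true x y
K-orbital (i , s) (j , t) with i ≟F j
... | no _ = refl
... | yes refl with s ≟B t
...   | yes _ = refl
...   | no _  = refl

coK-orbital : ∀ {m} (x y : V m) → coK m x y ≡ orbitalGraph false false x y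
coK-orbital (i , s) (j , t) with i ≟F j
... | no _ = refl
... | yes refl with s ≟B t
...   | yes _ = refl
...   | no _  = refl

mK2-orbital : ∀ {m} (x y : V m) → mK2 m x y ≡ orbitalGraph true false x y
mK2-orbital (i , s) (j , t) with i ≟F j
... | no _ = refl
... | yes refl with s ≟B t
...   | yes _ = refl
...   | no _  = refl

comK2-orbital : ∀ {m} (x y : V m) → comK2 m x y ≡ orbitalGraph false true x y
comK2-orbital (i , s) (j , t) with i ≟F j
... | no _ = refl
... | yes refl with s ≟B t
...   | yes _ = refl
...   | no _  = refl

IsOrbital : ∀ {m} → Graph m → Bool → Bool → Set
IsOrbital {m} Δ α β = ∀ (x y : V m) → adj Δ x y ≡ orbitalGraph α β x y

isoTo-orbital : ∀ {m} (Δ : Graph m) {α β} {a : V m → V m → Bool} →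
  IsOrbital Δ α β → (∀ x y → a x y ≡ orbitalGraph α β x y) → IsoTo Δ a
isoTo-orbital Δ Δ≡ a≡ = ↔-id _ , λ x y → trans (a≡ x y) (sym (Δ≡ x y))

orbital-models : ∀ {m} (Δ : Graph m) α β → IsOrbital Δ α β →
  IsoTo Δ (K m) ⊎ IsoTo Δ (coK m) ⊎ IsoTo Δ (mK2 m) ⊎ IsoTo Δ (comK2 m)
orbital-models Δ true  true  Δ≡ = inj₁ (isoTo-orbital Δ Δ≡ K-orbital)
orbital-models Δ false false Δ≡ = inj₂ (inj₁ (isoTo-orbital Δ Δ≡ coK-orbital))
orbital-models Δ true  false Δ≡ = inj₂ (inj₂ (inj₁ (isoTo-orbital Δ Δ≡ mK2-orbital)))
orbital-models Δ false true  Δ≡ = inj₂ (inj₂ (inj₂ (isoTo-orbital Δ Δ≡ comK2-orbital)))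

negate₀ : ∀ {k} → V (suc k) → V (suc k)
negate₀ (zero  , s) = zero , not s
negate₀ (suc i , s) = suc i , s

negate₀-involutive : ∀ {k} (x : V (suc k)) → negate₀ (negate₀ x) ≡ x
negate₀-involutive (zero  , true)  = refl
negate₀-involutive (zero  , false) = refl
negate₀-involutive (suc i , s)     = refl

negate₀↔ : ∀ {k} → V (suc k) ↔ V (suc k)
negate₀↔ = mk↔ₛ′ negate₀ negate₀ negate₀-involutive negate₀-involutive

orbital⇒negate₀-aut : ∀ {k} (Δ : Graph (suc k)) {α β} → IsOrbital Δ α β → IsAut Δ negate₀
orbital⇒negate₀-aut Δ {α} {β} Δ≡ x y = begin
  adj Δ (negate₀ x) (negate₀ y)          ≡⟨ Δ≡ (negate₀ x) (negate₀ y) ⟩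
  orbitalGraph α β (negate₀ x) (negate₀ y) ≡⟨ preserved x y ⟩
  orbitalGraph α β x y                   ≡⟨ Δ≡ x y ⟨
  adj Δ x y                              ∎
  where
  open ≡-Reasoning
  preserved : ∀ x y → orbitalGraph α β (negate₀ x) (negate₀ y) ≡ orbitalGraph α β x y
  preserved (zero  , true)  (zero  , true)  = refl
  preserved (zero  , true)  (zero  , false) = refl
  preserved (zero  , false) (zero  , true)  = refl
  preserved (zero  , false) (zero  , false) = refl
  preserved (zero  , _)     (suc _ , _)     = refl
  preserved (suc _ , _)     (zero  , _)     = refl
  preserved (suc _ , _)     (suc _ , _)     = refl

-- allV (suc k) unfolds to (zero , true) ∷ (zero , false) ∷ (vertices with index suc i).
moved-negate₀ : ∀ {k} → moved (negate₀ {k}) ≡ 2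
moved-negate₀ {k} = cong (λ xs → 2 + length xs) (filter-none (T? ∘ isMoved) (All.tabulate fixed))
  where
  isMoved : V (suc k) → Bool
  isMoved x = not ⌊ negate₀ x ≟V x ⌋
  fixed : ∀ {x} → x ∈ cartesianProduct (tabulate suc) (true ∷ false ∷ []) → ¬ T (isMoved x)
  fixed {i , _} x∈ with ∈-tabulate⁻ {f = suc} (proj₁ (∈-cartesianProduct⁻ _ _ x∈))
  ... | _ , refl = λ isMoved-x → toWitnessFalse isMoved-x refl

∈-allV : ∀ {m} (x : V m) → x ∈ allV m
∈-allV (i , true)  = ∈-cartesianProduct⁺ (∈-allFin i) (here refl)
∈-allV (i , false) = ∈-cartesianProduct⁺ (∈-allFin i) (there (here refl))

2≤moved : ∀ {m} (f : V m ↔ V m) {x} → Inverse.to f x ≢ x → 2 ≤ moved (Inverse.to f)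
2≤moved {m} f {x} fx≢x = distinct-members⇒2≤length
  (∈-filter⁺ (T? ∘ isMoved) (∈-allV x) (fromWitnessFalse fx≢x))
  (∈-filter⁺ (T? ∘ isMoved) (∈-allV (to x)) (fromWitnessFalse (fx≢x ∘ injective)))
  (fx≢x ∘ sym)
  where
  open Inverse f using (to)
  open Injection (↔⇒↣ f) using (injective)
  isMoved : V m → Bool
  isMoved y = not ⌊ to y ≟V y ⌋

motion-2 : ∀ {m} (Δ : Graph m) (f : V m ↔ V m) {x} →
  IsAut Δ (Inverse.to f) → Inverse.to f x ≢ x → moved (Inverse.to f) ≡ 2 → MotionIs Δ 2
motion-2 Δ f {x} aut fx≢x moved≡2 = (f , aut , (x , fx≢x) , moved≡2) , λ g _ (_ , gy≢y) → 2≤moved g gy≢y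

lemma3p11 : (m : ℕ) → 3 ≤ m → (Δ : Graph m) → WInvariant Δ →
    (IsoTo Δ (K m) ⊎ IsoTo Δ (coK m) ⊎ IsoTo Δ (mK2 m) ⊎ IsoTo Δ (comK2 m))
    × MotionIs Δ 2
lemma3p11 _ (s≤s (s≤s (s≤s {n = n} z≤n))) Δ W =
  orbital-models Δ _ _ Δ≡ ,
  motion-2 Δ negate₀↔ {zero , false} (orbital⇒negate₀-aut Δ Δ≡) (λ ())
    (moved-negate₀ {suc (suc n)})
  where
  Δ≡ : IsOrbital Δ _ _
  Δ≡ = adj-orbital Δ W
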